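{- Let $(\Sigma,<)$ be a finite totally ordered alphabet and let $\ell_1,\ldots,\ell_h$ be anti-Lyndon words with $\ell_1\ge_p\ell_2\ge_p\cdots\ge_p\ell_h$. Let $h\ge2$ and let $i$, $1\le i<h$, be such that $\ell_1=\ell_2=\cdots=\ell_i\neq\ell_{i+1}$. If there is $j$, $i<j\le h$, such that $\ell_{i+1}\cdots\ell_j$ is a prefix of $\ell_1\ell_2\cdots\ell_i$, then $\ell_{i+1}\cdots\ell_j$ is a prefix of $\ell_1$.
   Context: $x\ge_p y$ means $y$ is a prefix of $x$. Inverse order $<_{in}$ on $\Sigma$: $b<_{in}a\iff a<b$; $\prec_{in}$ the lexicographic order on $\Sigma^*$ induced by $<_{in}$ ($x\prec_{in}y$ if $x$ is a proper prefix of $y$, or $x=ras$, $y=rbt$ with $a<_{in}b$). An anti-Lyndon word is a nonempty primitive word strictly smaller for $\prec_{in}$ than all its other conjugates. -}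

module Defs where

open import Data.Nat using (ℕ; zero; suc)
open import Data.List using (List; []; _∷_; _++_; concat; replicate)
open import Data.Product using (Σ; ∃; _×_)
open import Relation.Binary.PropositionalEquality using (_≡_; _≢_)

module Words {A : Set} (_<_ : A → A → Set) where

  Word : Set
  Word = List A

  _≥ₚ_ : Word → Word → Set
  x ≥ₚ y = ∃ λ z → y ++ z ≡ x

  _<in_ : A → A → Set
  b <in a = a < b

  data _≺in_ : Word → Word → Set where
    prefix : ∀ {b t} → [] ≺in (b ∷ t)
    diff   : ∀ {a b s t} → a <in b → (a ∷ s) ≺in (b ∷ t)
    same   : ∀ {c x y} → x ≺in y → (c ∷ x) ≺in (c ∷ y)

  pow : Word → ℕ → Word
  pow u n = concat (replicate n u)

  Primitive : Word → Set
  Primitive w = ∀ u n → w ≡ pow u n → n ≡ 1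

  AntiLyndon : Word → Set
  AntiLyndon w = (w ≢ []) × Primitive w ×
    (∀ u v → w ≡ u ++ v → v ++ u ≢ w → w ≺in (v ++ u))

  segment : (ℕ → Word) → ℕ → ℕ → Word
  segment ℓ a zero = []
  segment ℓ a (suc n) = ℓ a ++ segment ℓ (suc a) n

{-# OPTIONS --safe #-}
-- An anti-Lyndon word L is unbordered. For a border L = v x = y v, either the
-- conjugate x v equals L, so x and v commute and L is a proper power, or both
-- conjugates x v and v y exceed L = v x; then x ≺ y, so x v ≺ y v = L.
-- Each of ℓ_{i+1}, …, ℓ_j is a proper prefix of ℓ_1 = L. Reading ℓ_{i+1} ⋯ ℓ_j
-- along the prefix L ℓ_2 ⋯ ℓ_i, a factor that crossed the end of the first copy
-- of L would exhibit a border of L, so every factor ends strictly inside L.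
module Submission where

open import Defs
open import Data.Nat using (ℕ; zero; suc; _≤_; _<_; _≤′_; ≤′-refl; ≤′-step; _∸_; _+_; s≤s; z≤n; z<s)
open import Data.Nat.Properties
  using (≤-refl; ≤-trans; ≤-pred; suc-injective; <⇒≤; ≤⇒≤′; ≤′⇒≤; +-suc; m<m+n; m<n+m; m+1+n≢0; m+[n∸m]≡n; +-cancelˡ-≡; +-comm)
open import Data.List using (List; []; _∷_; _++_; length)
open import Data.List.Properties
  using (++-assoc; ++-cancelˡ; ++-identityʳ; ++-conicalʳ; ≡-dec; length-++; ∷-injectiveˡ; ∷-injectiveʳ)
open import Data.List.Membership.Propositional using (_∈_)
open import Data.Product using (∃; ∃₂; _×_; _,_; proj₁; proj₂)
open import Data.Sum using (_⊎_; inj₁; inj₂; [_,_]′)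
open import Data.Empty using (⊥; ⊥-elim)
open import Function using (_∘_)
open import Relation.Nullary using (yes; no)
open import Relation.Binary.PropositionalEquality
  using (_≡_; _≢_; refl; sym; trans; cong; subst; module ≡-Reasoning)
open import Relation.Binary.Structures using (IsStrictTotalOrder)

open ≡-Reasoning

++-equidivisible : ∀ {A : Set} (a b c d : List A) → a ++ b ≡ c ++ d →
  (∃ λ m → a ≡ c ++ m × d ≡ m ++ b) ⊎ (∃ λ m → c ≡ a ++ m × b ≡ m ++ d)
++-equidivisible [] b c d eq = inj₂ (c , refl , eq)
++-equidivisible (x ∷ a) b [] d eq = inj₁ (x ∷ a , refl , sym eq)
++-equidivisible (x ∷ a) b (y ∷ c) d eq with ∷-injectiveˡ eq
... | refl with ++-equidivisible a b c d (∷-injectiveʳ eq)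
...   | inj₁ (m , a≡c++m , d≡m++b) = inj₁ (m , cong (x ∷_) a≡c++m , d≡m++b)
...   | inj₂ (m , c≡a++m , b≡m++d) = inj₂ (m , cong (x ∷_) c≡a++m , b≡m++d)

module AntiLyndonProperties {A : Set} (_<ₐ_ : A → A → Set) where
  open Words _<ₐ_

  pow-+ : ∀ u a b → pow u (a + b) ≡ pow u a ++ pow u b
  pow-+ u zero    b = refl
  pow-+ u (suc a) b = begin
    u ++ pow u (a + b)           ≡⟨ cong (u ++_) (pow-+ u a b) ⟩
    u ++ (pow u a ++ pow u b)    ≡⟨ ++-assoc u (pow u a) (pow u b) ⟨
    (u ++ pow u a) ++ pow u b    ∎

  CommonPower : Word → Word → Set
  CommonPower x y = ∃ λ u → ∃₂ λ a b → x ≡ pow u a × y ≡ pow u b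

  CommonPower-sym : ∀ {x y} → CommonPower x y → CommonPower y x
  CommonPower-sym (u , a , b , x≡uᵃ , y≡uᵇ) = u , b , a , y≡uᵇ , x≡uᵃ

  CommonPower-++ : ∀ {x y} → CommonPower x y → CommonPower x (x ++ y)
  CommonPower-++ (u , a , b , refl , refl) = u , a , a + b , refl , sym (pow-+ u a b)

  commute⇒CommonPower : ∀ {x y} → x ++ y ≡ y ++ x → CommonPower x y
  commute⇒CommonPower {x} {y} = go (length x + length y) x y ≤-refl
    where
    go : ∀ n x y → length x + length y ≤ n → x ++ y ≡ y ++ x → CommonPower x y
    go _ [] y _ _ = y , 0 , 1 , refl , sym (++-identityʳ y)
    go _ x [] _ _ = x , 1 , 0 , sym (++-identityʳ x) , refl
    go (suc n) x@(_ ∷ _) y@(_ ∷ _) size eq with ++-equidivisible x y y x eq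
    ... | inj₁ (m , x≡y++m , x≡m++y) =
      subst (λ t → CommonPower t y) (sym x≡y++m)
        (CommonPower-sym (CommonPower-++ (go n y m size′ (trans (sym x≡y++m) x≡m++y))))
      where
      size′ : length y + length m ≤ n
      size′ = subst (_≤ n) (trans (cong length x≡y++m) (length-++ y))
                (≤-pred (≤-trans (m<m+n (length x) z<s) size))
    ... | inj₂ (m , y≡x++m , y≡m++x) =
      subst (CommonPower x) (sym y≡x++m)
        (CommonPower-++ (go n x m size′ (trans (sym y≡x++m) y≡m++x)))
      where
      size′ : length x + length m ≤ n
      size′ = subst (_≤ n) (trans (cong length y≡x++m) (length-++ x))
                (≤-pred (≤-trans (m<n+m (length y) z<s) size))

  primitive-commute⇒trivial : ∀ {x y} → Primitive (x ++ y) → x ++ y ≡ y ++ x → x ≡ [] ⊎ y ≡ []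
  primitive-commute⇒trivial {x} {y} prim xy≡yx with commute⇒CommonPower xy≡yx
  ... | u , zero  , _     , x≡[] , _    = inj₁ x≡[]
  ... | u , _     , zero  , _    , y≡[] = inj₂ y≡[]
  ... | u , suc a , suc b , x≡uᵃ , y≡uᵇ =
    ⊥-elim (m+1+n≢0 a (suc-injective (prim u (suc a + suc b) xy≡uᵃ⁺ᵇ)))
    where
    xy≡uᵃ⁺ᵇ : x ++ y ≡ pow u (suc a + suc b)
    xy≡uᵃ⁺ᵇ = begin
      x ++ y                       ≡⟨ cong (_++ y) x≡uᵃ ⟩
      pow u (suc a) ++ y           ≡⟨ cong (pow u (suc a) ++_) y≡uᵇ ⟩
      pow u (suc a) ++ pow u (suc b) ≡⟨ pow-+ u (suc a) (suc b) ⟨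
      pow u (suc a + suc b)        ∎

  _>ₚ_ : Word → Word → Set
  x >ₚ y = ∃ λ z → z ≢ [] × y ++ z ≡ x

  ≥ₚ-refl : ∀ {x} → x ≥ₚ x
  ≥ₚ-refl {x} = [] , ++-identityʳ x

  ≥ₚ-trans : ∀ {x y z} → x ≥ₚ y → y ≥ₚ z → x ≥ₚ z
  ≥ₚ-trans {z = z} (p , y++p≡x) (q , z++q≡y) =
    q ++ p , trans (sym (++-assoc z q p)) (trans (cong (_++ p) z++q≡y) y++p≡x)

  >ₚ-≥ₚ-trans : ∀ {x y z} → x >ₚ y → y ≥ₚ z → x >ₚ z
  >ₚ-≥ₚ-trans (p , p≢[] , y++p≡x) (q , z++q≡y) =
    q ++ p , p≢[] ∘ ++-conicalʳ q p , proj₂ (≥ₚ-trans (p , y++p≡x) (q , z++q≡y))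

  ≥ₚ-≢⇒>ₚ : ∀ {x y} → x ≥ₚ y → x ≢ y → x >ₚ y
  ≥ₚ-≢⇒>ₚ {y = y} (z , y++z≡x) x≢y =
    z , (λ { refl → x≢y (trans (sym y++z≡x) (++-identityʳ y)) }) , y++z≡x

  ≥ₚ-descending : ∀ {ℓ : ℕ → Word} {a b} → (∀ k → a ≤ k → k < b → ℓ k ≥ₚ ℓ (suc k)) →
    ∀ {k} → a ≤′ k → k ≤ b → ℓ a ≥ₚ ℓ k
  ≥ₚ-descending step ≤′-refl _ = ≥ₚ-refl
  ≥ₚ-descending step (≤′-step {n = k} a≤′k) k<b =
    ≥ₚ-trans (≥ₚ-descending step a≤′k (<⇒≤ k<b)) (step k (≤′⇒≤ a≤′k) k<b)

  Unbordered : Word → Set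
  Unbordered w = ∀ {v y} → v ≢ [] → w >ₚ v → y ++ v ≢ w

  unbordered-extend : ∀ {L s u} Z → Unbordered L → L >ₚ s → L >ₚ u →
    (L ++ Z) ≥ₚ (s ++ u) → L >ₚ (s ++ u)
  unbordered-extend {L} {s} {u} Z unbordered (r , r≢[] , s++r≡L) (x , x≢[] , u++x≡L) (z , s++u++z≡L++Z)
    with ++-equidivisible u z r Z u++z≡r++Z
    where
    u++z≡r++Z : u ++ z ≡ r ++ Z
    u++z≡r++Z = ++-cancelˡ s (u ++ z) (r ++ Z) (begin
      s ++ (u ++ z)   ≡⟨ ++-assoc s u z ⟨
      (s ++ u) ++ z   ≡⟨ s++u++z≡L++Z ⟩
      L ++ Z          ≡⟨ cong (_++ Z) s++r≡L ⟨
      (s ++ r) ++ Z   ≡⟨ ++-assoc s r Z ⟩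
      s ++ (r ++ Z)   ∎)
  ... | inj₁ (m , u≡r++m , _) = ⊥-elim (unbordered r≢[] L>r s++r≡L)
    where
    L>r : L >ₚ r
    L>r = m ++ x , x≢[] ∘ ++-conicalʳ m x ,
          trans (sym (++-assoc r m x)) (trans (cong (_++ x) (sym u≡r++m)) u++x≡L)
  ... | inj₂ ([] , r≡u++[] , _) = ⊥-elim (unbordered r≢[] L>r s++r≡L)
    where
    L>r : L >ₚ r
    L>r = x , x≢[] , trans (cong (_++ x) (trans r≡u++[] (++-identityʳ u))) u++x≡L
  ... | inj₂ (c ∷ m , r≡u++c∷m , _) = c ∷ m , (λ ()) , (begin
      (s ++ u) ++ c ∷ m   ≡⟨ ++-assoc s u (c ∷ m) ⟩
      s ++ (u ++ c ∷ m)   ≡⟨ cong (s ++_) r≡u++c∷m ⟨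
      s ++ r              ≡⟨ s++r≡L ⟩
      L                   ∎)

  unbordered-segment-prefix : ∀ {L s} Z (ℓ : ℕ → Word) a n → Unbordered L →
    (∀ k → a ≤ k → k < a + n → L >ₚ ℓ k) → L >ₚ s →
    (L ++ Z) ≥ₚ (s ++ segment ℓ a n) → L ≥ₚ (s ++ segment ℓ a n)
  unbordered-segment-prefix {L} {s} Z ℓ a zero _ _ (r , _ , s++r≡L) _ =
    r , trans (cong (_++ r) (++-identityʳ s)) s++r≡L
  unbordered-segment-prefix {L} {s} Z ℓ a (suc n) unbordered proper L>s (z , eq) =
    subst (L ≥ₚ_) (++-assoc s (ℓ a) rest)
      (unbordered-segment-prefix Z ℓ (suc a) n unbordered proper′ L>s++ℓa (z , eq′))
    where
    rest = segment ℓ (suc a) n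
    eq′ : ((s ++ ℓ a) ++ rest) ++ z ≡ L ++ Z
    eq′ = trans (cong (_++ z) (++-assoc s (ℓ a) rest)) eq
    L>s++ℓa : L >ₚ (s ++ ℓ a)
    L>s++ℓa = unbordered-extend Z unbordered L>s (proper a ≤-refl (m<m+n a z<s))
                (rest ++ z , trans (sym (++-assoc (s ++ ℓ a) rest z)) eq′)
    proper′ : ∀ k → suc a ≤ k → k < suc a + n → L >ₚ ℓ k
    proper′ k a<k k<a+n = proper k (<⇒≤ a<k) (subst (k <_) (sym (+-suc a n)) k<a+n)

  module _ (sto : IsStrictTotalOrder _≡_ _<ₐ_) where
    open IsStrictTotalOrder sto using (irrefl; asym; _≟_)

    ≺in-asym : ∀ {x y} → x ≺in y → y ≺in x → ⊥
    ≺in-asym prefix   ()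
    ≺in-asym (diff p) (diff q) = asym p q
    ≺in-asym (diff p) (same q) = irrefl refl p
    ≺in-asym (same p) (diff q) = irrefl refl q
    ≺in-asym (same p) (same q) = ≺in-asym p q

    ≺in-cancelˡ : ∀ v {x y} → (v ++ x) ≺in (v ++ y) → x ≺in y
    ≺in-cancelˡ []      p        = p
    ≺in-cancelˡ (c ∷ v) (diff p) = ⊥-elim (irrefl refl p)
    ≺in-cancelˡ (c ∷ v) (same p) = ≺in-cancelˡ v p

    ≺in-++ : ∀ {x y} z w → length x ≡ length y → x ≺in y → (x ++ z) ≺in (y ++ w)
    ≺in-++ z w ()  prefix
    ≺in-++ z w _   (diff p) = diff p
    ≺in-++ z w |x|≡|y| (same p) = same (≺in-++ z w (suc-injective |x|≡|y|) p)

    antiLyndon⇒unbordered : ∀ {w} → AntiLyndon w → Unbordered w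
    antiLyndon⇒unbordered {w} (_ , prim , minimal) {v} {y} v≢[] (x , x≢[] , v++x≡w) y++v≡w
      with ≡-dec _≟_ (x ++ v) w
    ... | yes x++v≡w = [ v≢[] , x≢[] ]′
      (primitive-commute⇒trivial (subst Primitive (sym v++x≡w) prim) (trans v++x≡w (sym x++v≡w)))
    ... | no x++v≢w = ≺in-asym w≺x++v x++v≺w
      where
      v++y≢w : v ++ y ≢ w
      v++y≢w v++y≡w = x++v≢w (begin
        x ++ v   ≡⟨ cong (_++ v) (++-cancelˡ v y x (trans v++y≡w (sym v++x≡w))) ⟨
        y ++ v   ≡⟨ y++v≡w ⟩
        w        ∎)
      w≺x++v : w ≺in (x ++ v)
      w≺x++v = minimal v x (sym v++x≡w) x++v≢w
      x≺y : x ≺in y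
      x≺y = ≺in-cancelˡ v (subst (_≺in (v ++ y)) (sym v++x≡w) (minimal y v (sym y++v≡w) v++y≢w))
      |x|≡|y| : length x ≡ length y
      |x|≡|y| = +-cancelˡ-≡ (length v) (length x) (length y) (begin
        length v + length x   ≡⟨ length-++ v ⟨
        length (v ++ x)       ≡⟨ cong length (trans v++x≡w (sym y++v≡w)) ⟩
        length (y ++ v)       ≡⟨ length-++ y ⟩
        length y + length v   ≡⟨ +-comm (length y) (length v) ⟩
        length v + length y   ∎)
      x++v≺w : (x ++ v) ≺in w
      x++v≺w = subst ((x ++ v) ≺in_) y++v≡w (≺in-++ v v |x|≡|y| x≺y)

proposition9p5 : {A : Set} (_<ₐ_ : A → A → Set) → IsStrictTotalOrder _≡_ _<ₐ_ →
    (∃ λ (xs : List A) → ∀ a → a ∈ xs) →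
    (h : ℕ) → (ℓ : ℕ → List A) →
    (∀ k → 1 ≤ k → k ≤ h → Words.AntiLyndon _<ₐ_ (ℓ k)) →
    (∀ k → 1 ≤ k → k < h → Words._≥ₚ_ _<ₐ_ (ℓ k) (ℓ (suc k))) →
    2 ≤ h → (i : ℕ) → 1 ≤ i → i < h →
    (∀ k → 1 ≤ k → k ≤ i → ℓ k ≡ ℓ 1) → ℓ i ≢ ℓ (suc i) →
    (j : ℕ) → i < j → j ≤ h →
    Words._≥ₚ_ _<ₐ_ (Words.segment _<ₐ_ ℓ 1 i) (Words.segment _<ₐ_ ℓ (suc i) (j ∸ i)) →
    Words._≥ₚ_ _<ₐ_ (ℓ 1) (Words.segment _<ₐ_ ℓ (suc i) (j ∸ i))
proposition9p5 _<ₐ_ sto _ h ℓ antiLyndon descending 2≤h i@(suc i′) _ i<h constant ℓi≢ℓi+1 j i<j j≤h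
  prefix-of-power =
  unbordered-segment-prefix (segment ℓ 2 i′) ℓ (suc i) (j ∸ i) (antiLyndon⇒unbordered sto L-antiLyndon)
    proper-prefix (ℓ 1 , proj₁ L-antiLyndon , refl) prefix-of-power
  where
  open Words _<ₐ_
  open AntiLyndonProperties _<ₐ_
  L-antiLyndon : AntiLyndon (ℓ 1)
  L-antiLyndon = antiLyndon 1 ≤-refl (<⇒≤ 2≤h)
  ℓ1>ℓi+1 : ℓ 1 >ₚ ℓ (suc i)
  ℓ1>ℓi+1 = subst (_>ₚ ℓ (suc i)) (constant i (s≤s z≤n) ≤-refl)
              (≥ₚ-≢⇒>ₚ (descending i (s≤s z≤n) i<h) ℓi≢ℓi+1)
  proper-prefix : ∀ k → suc i ≤ k → k < suc i + (j ∸ i) → ℓ 1 >ₚ ℓ k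
  proper-prefix k i<k (s≤s k≤i+[j∸i]) = >ₚ-≥ₚ-trans ℓ1>ℓi+1
    (≥ₚ-descending (λ m i<m → descending m (≤-trans (s≤s z≤n) i<m)) (≤⇒≤′ i<k)
      (≤-trans (subst (k ≤_) (m+[n∸m]≡n (<⇒≤ i<j)) k≤i+[j∸i]) j≤h))
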